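{- Let $k\geq 2$ be an integer and $L=\{l_0<\dots<l_{|L|-1}\}$ a finite subset of $\mathbb{N}$ with $|L|\geq 2$. Then for every subset $A$ of $[k]^{<\mathbb{N}}$, \[ \frac{1}{|X_L|}\sum_{x\in X_L} \frac{1}{|L|}\sum_{i=0}^{|L|-1}\frac{|A\cap R_x(i)|}{|R_x(i)|} \;=\; \frac{1}{|L|}\sum_{n\in L}\frac{|A\cap[k]^n|}{k^n}. \] In particular, there exists a Carlson--Simpson tree $W$ of $[k]^{<\mathbb{N}}$ of dimension $|L|-1$ with level set $L(W)=L$ such that $\frac{1}{|L|}\sum_{j=0}^{|L|-1}\frac{|A\cap W(j)|}{|W(j)|}\geq \frac{1}{|L|}\sum_{n\in L}\frac{|A\cap[k]^n|}{k^n}$.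
   Context: $[k]=\{1,\dots,k\}$, $[k]^n$ words of length $n$ (functions $\{0,\dots,n-1\}\to[k]$), $[k]^{<n}=\bigcup_{i<n}[k]^i$, $[k]^{<\mathbb{N}}$ all words. Convolution: for $i\in\{0,\dots,|L|-1\}$ let $L_i=\{l\in L:l<l_i\}$ and $\overline{L}_i=\{0,\dots,l_i-1\}\setminus L_i$ (so $|\overline{L}_i|=l_i-i$). Let $X_L=[k]^{\max(L)-|L|+1}$. For $t\in[k]^i$ and $x\in X_L$, $\mathrm{cv}_L(t,x)$ is the word $z\in[k]^{l_i}$ with $z(l_j)=t(j)$ for $j<i$ and such that, listing $\overline{L}_i$ increasingly as $m_0<m_1<\cdots$, $z(m_j)=x(j)$ for $j<|\overline L_i|$. For $x\in X_L$ and $i\in\{0,\dots,|L|-1\}$, $R_x(i)=\{\mathrm{cv}_L(t,x):t\in[k]^i\}$. A left variable word is a finite sequence over $[k]\cup\{v\}$ with first letter $v$; $w(a)$ replaces $v$ by $a$. A Carlson--Simpson tree of dimension $m$ is $W=\{c\}\cup\{c^{\frown}w_0(a_0)^{\frown}\cdots^{\frown}w_n(a_n):n<m,a_i\in[k]\}$ ($c$ a word, $w_j$ left variable words), with levels $W(0)=\{c\}$, $W(j)=\{c^{\frown}w_0(a_0)^{\frown}\cdots^{\frown}w_{j-1}(a_{j-1}):a_i\in[k]\}\subseteq[k]^{\ell_j}$ and level set $L(W)=\{\ell_0<\dots<\ell_m\}$. -}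

module Defs where

open import Data.Nat as ℕ using (ℕ; zero; suc; _∸_; _^_)
open import Data.Fin using (Fin; toℕ)
open import Data.Fin.Properties using () renaming (_≟_ to _≟ᶠ_)
open import Data.Bool using (Bool; true; false; _∧_; if_then_else_)
open import Data.Maybe using (Maybe; just; nothing; fromMaybe)
open import Data.List using (List; []; _∷_; _++_; map; foldr; length; filterᵇ; take; lookup; concatMap; allFin; last)
open import Data.Bool.ListAction using (any)
open import Data.List.Properties using (≡-dec)
open import Data.Integer using (+_)
open import Data.Rational using (ℚ; 0ℚ; _+_; _*_; _/_)
open import Relation.Nullary.Decidable using (⌊_⌋)

Word : ℕ → Set
Word k = List (Fin k)

allWords : (k n : ℕ) → List (Word k)
allWords k zero    = [] ∷ []
allWords k (suc n) = concatMap (λ a → map (a ∷_) (allWords k n)) (allFin k)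

_∈ᵇ_ : {k : ℕ} → Word k → List (Word k) → Bool
z ∈ᵇ S = any (λ s → ⌊ ≡-dec _≟ᶠ_ z s ⌋) S

_∈ℕ_ : ℕ → List ℕ → Bool
p ∈ℕ Ls = any (λ l → ⌊ p ℕ.≟ l ⌋) Ls

Subset : ℕ → Set
Subset k = Word k → Bool

countIn : {k : ℕ} → Subset k → List (Word k) → ℕ → ℕ
countIn {k} A S n = length (filterᵇ (λ z → A z ∧ (z ∈ᵇ S)) (allWords k n))

-- |S| for a finite set S ⊆ [k]^n given by a list (counted as a set).
countSet : {k : ℕ} → List (Word k) → ℕ → ℕ
countSet S n = countIn (λ _ → true) S n

countLevel : {k : ℕ} → Subset k → ℕ → ℕ
countLevel {k} A n = countIn A (allWords k n) n

-- a / d as a rational; the convention a / 0 = 0 is never used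
-- (all denominators occurring below are positive).
frac : ℕ → ℕ → ℚ
frac a zero    = 0ℚ
frac a (suc d) = (+ a) / suc d

sumℚ : List ℚ → ℚ
sumℚ = foldr _+_ 0ℚ

-- cvScan p n Ls t x : produce n letters for positions p, p+1, …;
-- position in Ls takes the next letter of t, otherwise the next letter of x.
-- (The fallback [] is never reached when the lengths are as in the paper.)
cvScan : {k : ℕ} → ℕ → ℕ → List ℕ → Word k → Word k → Word k
cvScan p zero    Ls t x = []
cvScan p (suc n) Ls t x with p ∈ℕ Ls
cvScan p (suc n) Ls (a ∷ t) x       | true  = a ∷ cvScan (suc p) n Ls t x
cvScan p (suc n) Ls []      x       | true  = []
cvScan p (suc n) Ls t       (b ∷ x) | false = b ∷ cvScan (suc p) n Ls t x
cvScan p (suc n) Ls t       []      | false = []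

-- cv_L(t, x) for t ∈ [k]^i (i the index of l_i in L), x ∈ X_L.
-- L_i = {l_0,…,l_{i-1}} = take i L since L is listed increasingly.
cv : {k : ℕ} (L : List ℕ) → Fin (length L) → Word k → Word k → Word k
cv L i t x = cvScan 0 (lookup L i) (take (toℕ i) L) t x

-- Length of the words in X_L : max(L) - |L| + 1  (max L = last element).
xLen : List ℕ → ℕ
xLen L = (fromMaybe 0 (last L) ∸ length L) ℕ.+ 1

XL : (k : ℕ) → List ℕ → List (Word k)
XL k L = allWords k (xLen L)

-- R_x(i) = { cv_L(t,x) : t ∈ [k]^i }  (as a list; counted as a set below)
R : {k : ℕ} (L : List ℕ) → Word k → Fin (length L) → List (Word k)
R {k} L x i = map (λ t → cv L i t x) (allWords k (toℕ i))

innerAvg : {k : ℕ} → Subset k → (L : List ℕ) → Word k → ℚ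
innerAvg A L x =
  frac 1 (length L) *
  sumℚ (map (λ i → frac (countIn A (R L x i) (lookup L i))
                        (countSet (R L x i) (lookup L i)))
            (allFin (length L)))

lhs : (k : ℕ) → Subset k → List ℕ → ℚ
lhs k A L = frac 1 (k ^ xLen L) * sumℚ (map (innerAvg A L) (XL k L))

rhs : (k : ℕ) → Subset k → List ℕ → ℚ
rhs k A L = frac 1 (length L) * sumℚ (map (λ n → frac (countLevel A n) (k ^ n)) L)

-- A left variable word v w₁ … w_r over [k] ∪ {v} (v = nothing) is
-- represented by its tail w₁ … w_r; the first letter v is built in.
LVWord : ℕ → Set
LVWord k = List (Maybe (Fin k))

substLV : {k : ℕ} → LVWord k → Fin k → Word k
substLV w a = a ∷ map (fromMaybe a) w

record CSTree (k : ℕ) : Set where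
  constructor cstree
  field
    stem  : Word k
    vwords : List (LVWord k)

open CSTree public

dim : {k : ℕ} → CSTree k → ℕ
dim W = length (vwords W)

levelFrom : {k : ℕ} → Word k → List (LVWord k) → List (Word k)
levelFrom {k} c []       = c ∷ []
levelFrom {k} c (w ∷ ws) = concatMap (λ a → levelFrom (c ++ substLV w a) ws) (allFin k)

level : {k : ℕ} (W : CSTree k) → Fin (suc (dim W)) → List (Word k)
level W j = levelFrom (stem W) (take (toℕ j) (vwords W))

levelsFrom : {k : ℕ} → ℕ → List (LVWord k) → List ℕ
levelsFrom n []       = n ∷ []
levelsFrom n (w ∷ ws) = n ∷ levelsFrom (n ℕ.+ suc (length w)) ws

levelSet : {k : ℕ} → CSTree k → List ℕ
levelSet W = levelsFrom (length (stem W)) (vwords W)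

levelLen : {k : ℕ} (W : CSTree k) → Fin (suc (dim W)) → ℕ
levelLen W j = length (stem W) ℕ.+ sumLens (take (toℕ j) (vwords W))
  where
    sumLens : List (LVWord _) → ℕ
    sumLens = foldr (λ w s → suc (length w) ℕ.+ s) 0

treeAvg : {k : ℕ} → Subset k → CSTree k → ℚ
treeAvg A W =
  frac 1 (suc (dim W)) *
  sumℚ (map (λ j → frac (countIn A (level W j) (levelLen W j))
                        (countSet (level W j) (levelLen W j)))
            (allFin (suc (dim W))))

module Submission where

-- For each i the set R_x(i) is a *fibre* of a
-- Boolean mask of length l_i: the mask marks the positions l_0, …, l_{i-1},
-- cv_L(t, x) fills the marked positions with t and the others with x, and
-- R_x(i) is the set of words of length l_i whose unmarked letters spell a
-- prefix of x.  As x runs over X_L every such prefix occurs equally often, so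
-- averaging the density of A over the fibres gives the density of A on the
-- whole level (`fibre-average`); exchanging the averages over x and over i
-- gives the identity.  Moreover R_x(0), …, R_x(|L|-1) are exactly the levels
-- of the tree with stem x|l_0 whose variable words are cut out of the rest of
-- x (`Convolution.tree`), and an x whose inner average is at least the mean
-- yields the tree of the second claim.

open import Defs
open import Data.Nat using (ℕ; _≤_; _∸_; _<_)
open import Data.List using (List; length)
open import Data.List.Relation.Unary.Linked using (Linked)
open import Data.Rational using (ℚ) renaming (_≤_ to _≤ℚ_)
open import Data.Product using (_×_; Σ)
open import Relation.Binary.PropositionalEquality using (_≡_)

open import Algebra.Bundles using (CommutativeSemiring; CommutativeRing)

module ListSum {c ℓ} (S : CommutativeSemiring c ℓ) where
  open CommutativeSemiring S
  open import Data.List using ([]; _∷_; _++_; map; foldr; concatMap)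
  import Data.List.Properties as ListP
  import Relation.Binary.PropositionalEquality as ≡
  open import Algebra.Properties.CommutativeSemigroup +-commutativeSemigroup using (interchange)

  sum : List Carrier → Carrier
  sum = foldr _+_ 0#

  sum-++ : ∀ xs ys → sum (xs ++ ys) ≈ sum xs + sum ys
  sum-++ []       ys = sym (+-identityˡ (sum ys))
  sum-++ (x ∷ xs) ys = trans (+-congˡ (sum-++ xs ys)) (sym (+-assoc x (sum xs) (sum ys)))

  sum-concatMap : ∀ {A B : Set} (f : B → Carrier) (g : A → List B) xs →
    sum (map f (concatMap g xs)) ≈ sum (map (λ x → sum (map f (g x))) xs)
  sum-concatMap f g []       = refl
  sum-concatMap f g (x ∷ xs) = trans (reflexive (≡.cong sum (ListP.map-++ f (g x) (concatMap g xs))))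
    (trans (sum-++ (map f (g x)) _) (+-congˡ (sum-concatMap f g xs)))

  sum-0 : ∀ {A : Set} (xs : List A) → sum (map (λ _ → 0#) xs) ≈ 0#
  sum-0 []       = refl
  sum-0 (x ∷ xs) = trans (+-congˡ (sum-0 xs)) (+-identityˡ 0#)

  sum-+ : ∀ {A : Set} (f g : A → Carrier) xs →
    sum (map (λ x → f x + g x) xs) ≈ sum (map f xs) + sum (map g xs)
  sum-+ f g []       = sym (+-identityˡ 0#)
  sum-+ f g (x ∷ xs) = trans (+-congˡ (sum-+ f g xs)) (interchange (f x) (g x) _ _)

  sum-*ˡ : ∀ {A : Set} (a : Carrier) (f : A → Carrier) xs →
    sum (map (λ x → a * f x) xs) ≈ a * sum (map f xs)
  sum-*ˡ a f []       = sym (zeroʳ a)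
  sum-*ˡ a f (x ∷ xs) = trans (+-congˡ (sum-*ˡ a f xs)) (sym (distribˡ a (f x) _))

  sum-*ʳ : ∀ {A : Set} (a : Carrier) (f : A → Carrier) xs →
    sum (map (λ x → f x * a) xs) ≈ sum (map f xs) * a
  sum-*ʳ a f []       = sym (zeroˡ a)
  sum-*ʳ a f (x ∷ xs) = trans (+-congˡ (sum-*ʳ a f xs)) (sym (distribʳ a (f x) _))

  sum-swap : ∀ {A B : Set} (h : A → B → Carrier) xs ys →
    sum (map (λ x → sum (map (h x) ys)) xs) ≈ sum (map (λ y → sum (map (λ x → h x y) xs)) ys)
  sum-swap h []       ys = sym (sum-0 ys)
  sum-swap h (x ∷ xs) ys =
    trans (+-congˡ (sum-swap h xs ys)) (sym (sum-+ (h x) (λ y → sum (map (λ x → h x y) xs)) ys))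

open import Data.Bool using (Bool; true; false; _∧_; _∨_)
import Data.Bool.Properties as BoolP
open import Data.Fin as Fin using (Fin; toℕ)
import Data.Fin.Properties as FinP
import Data.Integer as ℤ
import Data.Integer.Properties as ℤP
import Data.Integer.Tactic.RingSolver as ℤSolver
import Data.Nat.Tactic.RingSolver as ℕSolver
open import Data.List using ([]; _∷_; _++_; map; foldr; filterᵇ; take; drop; lookup; concatMap; allFin; replicate; last)
import Data.List.Properties as ListP
open import Data.List.Membership.Propositional using (_∈_)
import Data.List.Membership.Propositional.Properties as ∈P
open import Data.List.Relation.Unary.All as All using (All; []; _∷_)
import Data.List.Relation.Unary.All.Properties as AllP
import Data.List.Relation.Unary.Any as Any
open import Data.List.Relation.Unary.Any using (here; there)
import Data.List.Relation.Unary.Any.Properties as AnyP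
open import Data.List.Relation.Unary.Linked using ([]; [-]; _∷_)
import Data.List.Relation.Unary.Linked.Properties as LinkedP
open import Data.Maybe using (just; fromMaybe)
open import Data.Nat as ℕ using (zero; suc; _+_; _*_; _^_; z≤n; s≤s; NonZero)
import Data.Nat.Properties as ℕP
open import Data.Product using (_,_; proj₁; proj₂)
import Data.Rational as ℚ
import Data.Rational.Properties as ℚP
import Data.Rational.Unnormalised as ℚᵘ
import Data.Rational.Unnormalised.Properties as ℚᵘP
open import Data.Sum using (inj₁; inj₂)
open import Function using (_∘_; mk⇔; Equivalence)
open import Relation.Nullary using (¬_)
open import Relation.Nullary.Decidable using (Dec; yes; no; ⌊_⌋; isYes≗does; dec-true; dec-false; does-⇔; toWitness; fromWitness; ⌊⌋-map′)
open import Relation.Binary.PropositionalEquality using (refl; sym; trans; cong; cong₂; subst; subst₂; module ≡-Reasoning)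

module ℕΣ = ListSum ℕP.+-*-commutativeSemiring
module ℚΣ = ListSum (CommutativeRing.commutativeSemiring ℚP.+-*-commutativeRing)

-- Fractions of natural numbers.  `frac a (suc d)` is the normalisation of
-- the unnormalised fraction a/(d+1), so identities between such fractions
-- reduce to cross-multiplication in ℚᵘ, transported by `fromℚᵘ`.

fromℚᵘ-+ : ∀ p q → ℚ.fromℚᵘ (p ℚᵘ.+ q) ≡ ℚ.fromℚᵘ p ℚ.+ ℚ.fromℚᵘ q
fromℚᵘ-+ p q = begin
  ℚ.fromℚᵘ (p ℚᵘ.+ q)                  ≡⟨ ℚP.fromℚᵘ-cong (ℚᵘP.+-cong (back p) (back q)) ⟩
  ℚ.fromℚᵘ (ℚ.toℚᵘ p′ ℚᵘ.+ ℚ.toℚᵘ q′)  ≡⟨ ℚP.fromℚᵘ-cong (ℚᵘP.≃-sym (ℚP.toℚᵘ-homo-+ p′ q′)) ⟩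
  ℚ.fromℚᵘ (ℚ.toℚᵘ (p′ ℚ.+ q′))        ≡⟨ ℚP.fromℚᵘ-toℚᵘ (p′ ℚ.+ q′) ⟩
  p′ ℚ.+ q′                            ∎
  where
  open ≡-Reasoning
  p′ = ℚ.fromℚᵘ p
  q′ = ℚ.fromℚᵘ q
  back : ∀ r → r ℚᵘ.≃ ℚ.toℚᵘ (ℚ.fromℚᵘ r)
  back r = ℚᵘP.≃-sym (ℚP.toℚᵘ-fromℚᵘ r)

fromℚᵘ-* : ∀ p q → ℚ.fromℚᵘ (p ℚᵘ.* q) ≡ ℚ.fromℚᵘ p ℚ.* ℚ.fromℚᵘ q
fromℚᵘ-* p q = begin
  ℚ.fromℚᵘ (p ℚᵘ.* q)                  ≡⟨ ℚP.fromℚᵘ-cong (ℚᵘP.*-cong (back p) (back q)) ⟩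
  ℚ.fromℚᵘ (ℚ.toℚᵘ p′ ℚᵘ.* ℚ.toℚᵘ q′)  ≡⟨ ℚP.fromℚᵘ-cong (ℚᵘP.≃-sym (ℚP.toℚᵘ-homo-* p′ q′)) ⟩
  ℚ.fromℚᵘ (ℚ.toℚᵘ (p′ ℚ.* q′))        ≡⟨ ℚP.fromℚᵘ-toℚᵘ (p′ ℚ.* q′) ⟩
  p′ ℚ.* q′                            ∎
  where
  open ≡-Reasoning
  p′ = ℚ.fromℚᵘ p
  q′ = ℚ.fromℚᵘ q
  back : ∀ r → r ℚᵘ.≃ ℚ.toℚᵘ (ℚ.fromℚᵘ r)
  back r = ℚᵘP.≃-sym (ℚP.toℚᵘ-fromℚᵘ r)

frac-0 : ∀ d .{{_ : NonZero d}} → frac 0 d ≡ ℚ.0ℚ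
frac-0 (suc d) = ℚP.0/n≡0 (suc d)

frac-+ : ∀ a b d .{{_ : NonZero d}} → frac a d ℚ.+ frac b d ≡ frac (a + b) d
frac-+ a b (suc d) =
  trans (sym (fromℚᵘ-+ (ℚᵘ.mkℚᵘ (ℤ.+ a) d) (ℚᵘ.mkℚᵘ (ℤ.+ b) d)))
        (ℚP.fromℚᵘ-cong {ℚᵘ.mkℚᵘ (ℤ.+ a) d ℚᵘ.+ ℚᵘ.mkℚᵘ (ℤ.+ b) d} {ℚᵘ.mkℚᵘ (ℤ.+ (a + b)) d}
                        (ℚᵘ.*≡* cross))
  where
  D = ℤ.+ suc d
  cross : (ℤ.+ a ℤ.* D ℤ.+ ℤ.+ b ℤ.* D) ℤ.* D ≡ ℤ.+ (a + b) ℤ.* ℤ.+ (suc d * suc d)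
  cross = begin
    (ℤ.+ a ℤ.* D ℤ.+ ℤ.+ b ℤ.* D) ℤ.* D   ≡⟨ factor (ℤ.+ a) (ℤ.+ b) D ⟩
    (ℤ.+ a ℤ.+ ℤ.+ b) ℤ.* (D ℤ.* D)       ≡⟨ cong₂ ℤ._*_ (sym (ℤP.pos-+ a b)) (sym (ℤP.pos-* (suc d) (suc d))) ⟩
    ℤ.+ (a + b) ℤ.* ℤ.+ (suc d * suc d)   ∎
    where
    open ≡-Reasoning
    factor : ∀ x y z → (x ℤ.* z ℤ.+ y ℤ.* z) ℤ.* z ≡ (x ℤ.+ y) ℤ.* (z ℤ.* z)
    factor = ℤSolver.solve-∀

frac-* : ∀ a d e .{{_ : NonZero d}} .{{_ : NonZero e}} → frac 1 d ℚ.* frac a e ≡ frac a (d * e)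
frac-* a (suc d) (suc e) =
  trans (sym (fromℚᵘ-* (ℚᵘ.mkℚᵘ (ℤ.+ 1) d) (ℚᵘ.mkℚᵘ (ℤ.+ a) e)))
        (ℚP.fromℚᵘ-cong {ℚᵘ.mkℚᵘ (ℤ.+ 1) d ℚᵘ.* ℚᵘ.mkℚᵘ (ℤ.+ a) e} {ℚᵘ.mkℚᵘ (ℤ.+ a) (e + d * suc e)}
                        (ℚᵘ.*≡* (cong (ℤ._* ℤ.+ (suc d * suc e)) (ℤP.*-identityˡ (ℤ.+ a)))))

frac-cancel : ∀ a c d .{{_ : NonZero c}} .{{_ : NonZero d}} → frac (c * a) (c * d) ≡ frac a d
frac-cancel a (suc c) (suc d) =
  ℚP.fromℚᵘ-cong {ℚᵘ.mkℚᵘ (ℤ.+ (suc c * a)) (d + c * suc d)} {ℚᵘ.mkℚᵘ (ℤ.+ a) d} (ℚᵘ.*≡* (begin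
    ℤ.+ (suc c * a) ℤ.* ℤ.+ suc d   ≡⟨ sym (ℤP.pos-* (suc c * a) (suc d)) ⟩
    ℤ.+ (suc c * a * suc d)         ≡⟨ cong ℤ.+_ (reorder (suc c) a (suc d)) ⟩
    ℤ.+ (a * (suc c * suc d))       ≡⟨ ℤP.pos-* a (suc c * suc d) ⟩
    ℤ.+ a ℤ.* ℤ.+ (suc c * suc d)   ∎))
  where
  open ≡-Reasoning
  reorder : ∀ x y z → x * y * z ≡ y * (x * z)
  reorder = ℕSolver.solve-∀

frac-sum : ∀ {A : Set} (f : A → ℕ) d .{{_ : NonZero d}} xs →
  sumℚ (map (λ x → frac (f x) d) xs) ≡ frac (ℕΣ.sum (map f xs)) d
frac-sum f d []       = sym (frac-0 d)
frac-sum f d (x ∷ xs) = trans (cong (frac (f x) d ℚ.+_) (frac-sum f d xs)) (frac-+ (f x) _ d)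

average-swap : ∀ {A B : Set} (h : A → B → ℚ) (a b : ℚ) xs ys →
  a ℚ.* sumℚ (map (λ x → b ℚ.* sumℚ (map (h x) ys)) xs) ≡
  b ℚ.* sumℚ (map (λ y → a ℚ.* sumℚ (map (λ x → h x y) xs)) ys)
average-swap h a b xs ys = begin
  a ℚ.* sumℚ (map (λ x → b ℚ.* sumℚ (map (h x) ys)) xs)      ≡⟨ cong (a ℚ.*_) (ℚΣ.sum-*ˡ b _ xs) ⟩
  a ℚ.* (b ℚ.* sumℚ (map (λ x → sumℚ (map (h x) ys)) xs))    ≡⟨ swap-factors a b _ ⟩
  b ℚ.* (a ℚ.* sumℚ (map (λ x → sumℚ (map (h x) ys)) xs))    ≡⟨ cong (λ s → b ℚ.* (a ℚ.* s)) (ℚΣ.sum-swap h xs ys) ⟩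
  b ℚ.* (a ℚ.* sumℚ (map (λ y → sumℚ (map (λ x → h x y) xs)) ys)) ≡⟨ cong (b ℚ.*_) (sym (ℚΣ.sum-*ˡ a _ ys)) ⟩
  b ℚ.* sumℚ (map (λ y → a ℚ.* sumℚ (map (λ x → h x y) xs)) ys) ∎
  where
  open ≡-Reasoning
  swap-factors : ∀ p q r → p ℚ.* (q ℚ.* r) ≡ q ℚ.* (p ℚ.* r)
  swap-factors p q r =
    trans (sym (ℚP.*-assoc p q r)) (trans (cong (ℚ._* r) (ℚP.*-comm p q)) (ℚP.*-assoc q p r))

sumℚ-const : ∀ {A : Set} (c : ℚ) (xs : List A) → sumℚ (map (λ _ → c) xs) ≡ frac (length xs) 1 ℚ.* c
sumℚ-const c []       = sym (trans (cong (ℚ._* c) (frac-0 1)) (ℚP.*-zeroˡ c))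
sumℚ-const c (x ∷ xs) = begin
  c ℚ.+ sumℚ (map (λ _ → c) xs)                  ≡⟨ cong₂ ℚ._+_ (sym (ℚP.*-identityˡ c)) (sumℚ-const c xs) ⟩
  ℚ.1ℚ ℚ.* c ℚ.+ frac (length xs) 1 ℚ.* c        ≡⟨ sym (ℚP.*-distribʳ-+ c ℚ.1ℚ (frac (length xs) 1)) ⟩
  (ℚ.1ℚ ℚ.+ frac (length xs) 1) ℚ.* c            ≡⟨ cong (ℚ._* c) (frac-+ 1 (length xs) 1) ⟩
  frac (suc (length xs)) 1 ℚ.* c                 ∎
  where open ≡-Reasoning

average-const : ∀ n .{{_ : NonZero n}} (c : ℚ) → frac 1 n ℚ.* (frac n 1 ℚ.* c) ≡ c
average-const n c = begin
  frac 1 n ℚ.* (frac n 1 ℚ.* c)    ≡⟨ sym (ℚP.*-assoc (frac 1 n) (frac n 1) c) ⟩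
  frac 1 n ℚ.* frac n 1 ℚ.* c      ≡⟨ cong (ℚ._* c) (frac-* n n 1) ⟩
  frac n (n * 1) ℚ.* c             ≡⟨ cong (λ a → frac a (n * 1) ℚ.* c) (sym (ℕP.*-identityʳ n)) ⟩
  frac (n * 1) (n * 1) ℚ.* c       ≡⟨ cong (ℚ._* c) (frac-cancel 1 n 1) ⟩
  ℚ.1ℚ ℚ.* c                       ≡⟨ ℚP.*-identityˡ c ⟩
  c                                ∎
  where open ≡-Reasoning

average-≤ : ∀ {A : Set} (f : A → ℚ) (c : ℚ) x xs → All (λ y → f y ≤ℚ c) (x ∷ xs) →
  frac 1 (length (x ∷ xs)) ℚ.* sumℚ (map f (x ∷ xs)) ≤ℚ c
average-≤ f c x xs bounded = subst (_ ≤ℚ_) (average-const (length (x ∷ xs)) c)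
  (ℚP.*-monoˡ-≤-nonNeg (frac 1 (length (x ∷ xs))) {{ℚP.normalize-nonNeg 1 (length (x ∷ xs))}}
    (subst (_ ≤ℚ_) (sumℚ-const c (x ∷ xs)) (sum-mono (x ∷ xs) bounded)))
  where
  sum-mono : ∀ ys → All (λ y → f y ≤ℚ c) ys → sumℚ (map f ys) ≤ℚ sumℚ (map (λ _ → c) ys)
  sum-mono []       []       = ℚP.≤-refl
  sum-mono (y ∷ ys) (h ∷ hs) = ℚP.+-mono-≤ h (sum-mono ys hs)

argmax : ∀ {A : Set} (f : A → ℚ) x xs → Σ A (λ b → b ∈ (x ∷ xs) × All (λ y → f y ≤ℚ f b) (x ∷ xs))
argmax f x [] = x , here refl , (ℚP.≤-refl ∷ [])
argmax f x (x′ ∷ xs) with argmax f x′ xs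
... | b , b∈ , below with ℚP.≤-total (f x) (f b)
...   | inj₁ x≤b = b , there b∈ , (x≤b ∷ below)
...   | inj₂ b≤x = x , here refl , (ℚP.≤-refl ∷ All.map (λ y≤b → ℚP.≤-trans y≤b b≤x) below)

above-average : ∀ {A : Set} (f : A → ℚ) xs {y : A} → y ∈ xs →
  Σ A (λ b → b ∈ xs × frac 1 (length xs) ℚ.* sumℚ (map f xs) ≤ℚ f b)
above-average f (x ∷ xs) _ with argmax f x xs
... | b , b∈ , below = b , b∈ , average-≤ f (f b) x xs below

average-reindex : ∀ {a b} → a ≡ b → (f : Fin a → ℚ) (g : Fin b → ℚ) → (∀ i j → toℕ i ≡ toℕ j → f i ≡ g j) →
  frac 1 a ℚ.* sumℚ (map f (allFin a)) ≡ frac 1 b ℚ.* sumℚ (map g (allFin b))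
average-reindex {a} refl f g f≡g = cong (λ s → frac 1 a ℚ.* sumℚ s) (ListP.map-cong (λ i → f≡g i i refl) (allFin a))

map-lookup : ∀ {A B : Set} (f : A → B) (xs : List A) → map (λ i → f (lookup xs i)) (allFin (length xs)) ≡ map f xs
map-lookup f xs = trans (ListP.map-tabulate (λ i → i) (λ i → f (lookup xs i)))
  (trans (sym (ListP.map-tabulate (lookup xs) f)) (cong (map f) (ListP.tabulate-lookup xs)))

ind : Bool → ℕ
ind true  = 1
ind false = 0

ind-∧ : ∀ b c → ind (b ∧ c) ≡ ind b * ind c
ind-∧ true  c = sym (ℕP.+-identityʳ (ind c))
ind-∧ false c = refl

length-filterᵇ : ∀ {A : Set} (p : A → Bool) xs → length (filterᵇ p xs) ≡ ℕΣ.sum (map (ind ∘ p) xs)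
length-filterᵇ p []       = refl
length-filterᵇ p (x ∷ xs) with p x
... | true  = cong suc (length-filterᵇ p xs)
... | false = length-filterᵇ p xs

isYes-true : ∀ {P : Set} (d : Dec P) → P → ⌊ d ⌋ ≡ true
isYes-true d p = trans (isYes≗does d) (dec-true d p)

isYes-false : ∀ {P : Set} (d : Dec P) → ¬ P → ⌊ d ⌋ ≡ false
isYes-false d ¬p = trans (isYes≗does d) (dec-false d ¬p)

map-allFin-suc : ∀ {A : Set} {k} (f : Fin (suc k) → A) →
  map f (allFin (suc k)) ≡ f Fin.zero ∷ map (f ∘ Fin.suc) (allFin k)
map-allFin-suc f = cong (f Fin.zero ∷_)
  (trans (ListP.map-tabulate Fin.suc f) (sym (ListP.map-tabulate (λ i → i) (f ∘ Fin.suc))))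

count-letter : ∀ {k} (b : Fin k) → ℕΣ.sum (map (λ a → ind ⌊ a FinP.≟ b ⌋) (allFin k)) ≡ 1
count-letter {suc k} Fin.zero    =
  trans (cong ℕΣ.sum (map-allFin-suc {k = k} (λ a → ind ⌊ a FinP.≟ Fin.zero ⌋))) (cong suc (ℕΣ.sum-0 (allFin k)))
count-letter {suc k} (Fin.suc b) = trans (cong ℕΣ.sum (map-allFin-suc {k = k} (λ a → ind ⌊ a FinP.≟ Fin.suc b ⌋)))
  (trans (cong ℕΣ.sum (ListP.map-cong (λ a → cong ind (⌊⌋-map′ _ _ (a FinP.≟ b))) (allFin k)))
         (count-letter b))

length-take-≤ : ∀ {A : Set} n (xs : List A) → n ≤ length xs → length (take n xs) ≡ n
length-take-≤ n xs n≤ = trans (ListP.length-take n xs) (ℕP.m≤n⇒m⊓n≡m n≤)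

length-as-sum : ∀ {A : Set} (xs : List A) → length xs ≡ ℕΣ.sum (map (λ _ → 1) xs)
length-as-sum []       = refl
length-as-sum (x ∷ xs) = cong suc (length-as-sum xs)

sum-constℕ : ∀ {A : Set} (c : ℕ) (xs : List A) → ℕΣ.sum (map (λ _ → c) xs) ≡ length xs * c
sum-constℕ c []       = refl
sum-constℕ c (x ∷ xs) = cong (c +_) (sum-constℕ c xs)

module _ {k : ℕ} where

  _≡ʷ_ : Word k → Word k → Bool
  z ≡ʷ w = ⌊ ListP.≡-dec FinP._≟_ z w ⌋

  ≡ʷ-sound : ∀ {z w} → z ≡ʷ w ≡ true → z ≡ w
  ≡ʷ-sound h = toWitness (Equivalence.from BoolP.T-≡ h)

  ≡ʷ-complete : ∀ {z w} → z ≡ w → z ≡ʷ w ≡ true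
  ≡ʷ-complete {z} {w} = isYes-true (ListP.≡-dec FinP._≟_ z w)

  ≡ʷ-sym : ∀ z w → z ≡ʷ w ≡ w ≡ʷ z
  ≡ʷ-sym z w = trans (isYes≗does (ListP.≡-dec FinP._≟_ z w))
    (trans (does-⇔ (mk⇔ sym sym) (ListP.≡-dec FinP._≟_ z w) (ListP.≡-dec FinP._≟_ w z)) (sym (isYes≗does (ListP.≡-dec FinP._≟_ w z))))

  ≡ʷ-cons : ∀ (a b : Fin k) z w → (a ∷ z) ≡ʷ (b ∷ w) ≡ ⌊ a FinP.≟ b ⌋ ∧ (z ≡ʷ w)
  ≡ʷ-cons a b z w with a FinP.≟ b | ListP.≡-dec FinP._≟_ z w
  ... | yes refl | yes refl = refl
  ... | yes refl | no _     = refl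
  ... | no _     | _        = refl

  ∈ᵇ-sound : ∀ {z : Word k} S → z ∈ᵇ S ≡ true → z ∈ S
  ∈ᵇ-sound S h = Any.map toWitness (AnyP.any⁻ _ S (Equivalence.from BoolP.T-≡ h))

  ∈ᵇ-complete : ∀ {z : Word k} {S} → z ∈ S → z ∈ᵇ S ≡ true
  ∈ᵇ-complete z∈S = Equivalence.to BoolP.T-≡ (AnyP.any⁺ _ (Any.map fromWitness z∈S))

  allWords-sound : ∀ n → All (λ z → length z ≡ n) (allWords k n)
  allWords-sound zero    = refl ∷ []
  allWords-sound (suc n) = AllP.concat⁺ (AllP.map⁺ (AllP.tabulate⁺ {f = λ a → a}
    (λ a → AllP.map⁺ {f = a ∷_} (All.map (cong suc) (allWords-sound n)))))

  allWords-complete : ∀ (z : Word k) → z ∈ allWords k (length z)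
  allWords-complete []      = here refl
  allWords-complete (a ∷ z) = ∈P.∈-concat⁺′ (∈P.∈-map⁺ (a ∷_) (allWords-complete z))
    (∈P.∈-map⁺ (λ b → map (b ∷_) (allWords k (length z))) (∈P.∈-allFin a))

  sum-allWords-suc : ∀ n (f : Word k → ℕ) →
    ℕΣ.sum (map f (allWords k (suc n))) ≡
    ℕΣ.sum (map (λ a → ℕΣ.sum (map (λ z → f (a ∷ z)) (allWords k n))) (allFin k))
  sum-allWords-suc n f = trans (ℕΣ.sum-concatMap f _ (allFin k))
    (cong ℕΣ.sum (ListP.map-cong (λ a → cong ℕΣ.sum (sym (ListP.map-∘ (allWords k n)))) (allFin k)))

  allWords-length : ∀ n → length (allWords k n) ≡ k ^ n
  allWords-length zero    = refl
  allWords-length (suc n) = begin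
    length (allWords k (suc n))                                          ≡⟨ length-as-sum (allWords k (suc n)) ⟩
    ℕΣ.sum (map (λ _ → 1) (allWords k (suc n)))                          ≡⟨ sum-allWords-suc n (λ _ → 1) ⟩
    ℕΣ.sum (map (λ _ → ℕΣ.sum (map (λ _ → 1) (allWords k n))) (allFin k)) ≡⟨ cong ℕΣ.sum (ListP.map-cong (λ _ → level-size) (allFin k)) ⟩
    ℕΣ.sum (map (λ _ → k ^ n) (allFin k))                                ≡⟨ sum-constℕ (k ^ n) (allFin k) ⟩
    length (allFin k) * k ^ n                                            ≡⟨ cong (_* k ^ n) (ListP.length-tabulate {n = k} (λ a → a)) ⟩
    k * k ^ n                                                            ∎
    where
    open ≡-Reasoning
    level-size : ℕΣ.sum (map (λ _ → 1) (allWords k n)) ≡ k ^ n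
    level-size = trans (sym (length-as-sum (allWords k n))) (allWords-length n)

  sum-cons-match : ∀ (b : Fin k) (π : Word k → Word k) w zs →
    ℕΣ.sum (map (λ a → ℕΣ.sum (map (λ z → ind ((a ∷ π z) ≡ʷ (b ∷ w))) zs)) (allFin k)) ≡
    ℕΣ.sum (map (λ z → ind (π z ≡ʷ w)) zs)
  sum-cons-match b π w zs = begin
    ℕΣ.sum (map (λ a → ℕΣ.sum (map (λ z → ind ((a ∷ π z) ≡ʷ (b ∷ w))) zs)) (allFin k))
      ≡⟨ cong ℕΣ.sum (ListP.map-cong (λ a → trans (cong ℕΣ.sum (ListP.map-cong (split a) zs)) (ℕΣ.sum-*ˡ (δ a) _ zs)) (allFin k)) ⟩
    ℕΣ.sum (map (λ a → δ a * C) (allFin k))    ≡⟨ ℕΣ.sum-*ʳ C δ (allFin k) ⟩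
    ℕΣ.sum (map δ (allFin k)) * C              ≡⟨ cong (_* C) (count-letter b) ⟩
    1 * C                                      ≡⟨ ℕP.*-identityˡ C ⟩
    C                                          ∎
    where
    open ≡-Reasoning
    δ : Fin k → ℕ
    δ a = ind ⌊ a FinP.≟ b ⌋
    C = ℕΣ.sum (map (λ z → ind (π z ≡ʷ w)) zs)
    split : ∀ a z → ind ((a ∷ π z) ≡ʷ (b ∷ w)) ≡ δ a * ind (π z ≡ʷ w)
    split a z = trans (cong ind (≡ʷ-cons a b (π z) w)) (ind-∧ ⌊ a FinP.≟ b ⌋ _)

  count-prefix : ∀ N f (u : Word k) → length u ≡ f → f ≤ N →
    ℕΣ.sum (map (λ x → ind (take f x ≡ʷ u)) (allWords k N)) ≡ k ^ (N ∸ f)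
  count-prefix N zero [] _ _ =
    trans (sum-constℕ 1 (allWords k N)) (trans (ℕP.*-identityʳ _) (allWords-length N))
  count-prefix (suc N) (suc f) (b ∷ u) |u|≡f (s≤s f≤N) =
    trans (sum-allWords-suc N _)
          (trans (sum-cons-match b (take f) u (allWords k N))
                 (count-prefix N f u (ℕP.suc-injective |u|≡f) f≤N))

-- Masks.  A mask is a list of Booleans: a `true` position is filled from a
-- word of fixed letters, a `false` position from a word of free letters.

Mask : Set
Mask = List Bool

trues : Mask → ℕ
trues []          = 0
trues (true ∷ m)  = suc (trues m)
trues (false ∷ m) = trues m

falses : Mask → ℕ
falses []          = 0
falses (true ∷ m)  = falses m
falses (false ∷ m) = suc (falses m)

length-mask : ∀ m → length m ≡ trues m + falses m
length-mask []          = refl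
length-mask (true ∷ m)  = cong suc (length-mask m)
length-mask (false ∷ m) = trans (cong suc (length-mask m)) (sym (ℕP.+-suc (trues m) (falses m)))

module _ {k : ℕ} where

  merge : Mask → Word k → Word k → Word k
  merge []          y       t       = []
  merge (true ∷ m)  y       (a ∷ t) = a ∷ merge m y t
  merge (true ∷ m)  y       []      = []
  merge (false ∷ m) (b ∷ y) t       = b ∷ merge m y t
  merge (false ∷ m) []      t       = []

  free : Mask → Word k → Word k
  free []          z       = []
  free (true ∷ m)  (a ∷ z) = free m z
  free (false ∷ m) (a ∷ z) = a ∷ free m z
  free (_ ∷ m)     []      = []

  fixed : Mask → Word k → Word k
  fixed []          z       = []
  fixed (true ∷ m)  (a ∷ z) = a ∷ fixed m z
  fixed (false ∷ m) (a ∷ z) = fixed m z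
  fixed (_ ∷ m)     []      = []

  merge-free-fixed : ∀ m (z : Word k) → length z ≡ length m → merge m (free m z) (fixed m z) ≡ z
  merge-free-fixed []          []      _  = refl
  merge-free-fixed (true ∷ m)  (a ∷ z) eq = cong (a ∷_) (merge-free-fixed m z (ℕP.suc-injective eq))
  merge-free-fixed (false ∷ m) (a ∷ z) eq = cong (a ∷_) (merge-free-fixed m z (ℕP.suc-injective eq))

  free-merge : ∀ m (y t : Word k) → length y ≡ falses m → length t ≡ trues m → free m (merge m y t) ≡ y
  free-merge []          []      []      _  _  = refl
  free-merge (true ∷ m)  y       (a ∷ t) ey et = free-merge m y t ey (ℕP.suc-injective et)
  free-merge (false ∷ m) (b ∷ y) t       ey et = cong (b ∷_) (free-merge m y t (ℕP.suc-injective ey) et)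

  merge-take : ∀ m (y t : Word k) → merge m y t ≡ merge m (take (falses m) y) t
  merge-take []          y       t       = refl
  merge-take (true ∷ m)  y       (a ∷ t) = cong (a ∷_) (merge-take m y t)
  merge-take (true ∷ m)  y       []      = refl
  merge-take (false ∷ m) (b ∷ y) t       = cong (b ∷_) (merge-take m y t)
  merge-take (false ∷ m) []      t       = refl

  length-free : ∀ m (z : Word k) → length z ≡ length m → length (free m z) ≡ falses m
  length-free []          []      _  = refl
  length-free (true ∷ m)  (a ∷ z) eq = length-free m z (ℕP.suc-injective eq)
  length-free (false ∷ m) (a ∷ z) eq = cong suc (length-free m z (ℕP.suc-injective eq))

  length-fixed : ∀ m (z : Word k) → length z ≡ length m → length (fixed m z) ≡ trues m
  length-fixed []          []      _  = refl
  length-fixed (true ∷ m)  (a ∷ z) eq = cong suc (length-fixed m z (ℕP.suc-injective eq))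
  length-fixed (false ∷ m) (a ∷ z) eq = length-fixed m z (ℕP.suc-injective eq)

  fibre : Mask → Word k → List (Word k)
  fibre m y = map (merge m y) (allWords k (trues m))

  ∈-fibre : ∀ m (y z : Word k) → falses m ≤ length y → length z ≡ length m →
    (z ∈ᵇ fibre m y) ≡ (free m z ≡ʷ take (falses m) y)
  ∈-fibre m y z f≤|y| |z|≡|m| = BoolP.⇔→≡ (mk⇔ to from)
    where
    f = falses m
    y′ = take f y
    |y′|≡f : length y′ ≡ f
    |y′|≡f = length-take-≤ f y f≤|y|
    to : z ∈ᵇ fibre m y ≡ true → free m z ≡ʷ y′ ≡ true
    to z∈ with ∈P.∈-map⁻ (merge m y) (∈ᵇ-sound (fibre m y) z∈)
    ... | t , t∈ , refl = ≡ʷ-complete (trans (cong (free m) (merge-take m y t))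
      (free-merge m y′ t |y′|≡f (All.lookup (allWords-sound (trues m)) t∈)))
    from : free m z ≡ʷ y′ ≡ true → z ∈ᵇ fibre m y ≡ true
    from free≡ = ∈ᵇ-complete (subst (_∈ fibre m y) merged (∈P.∈-map⁺ (merge m y) fixed∈))
      where
      fixed∈ : fixed m z ∈ allWords k (trues m)
      fixed∈ = subst (λ n → fixed m z ∈ allWords k n) (length-fixed m z |z|≡|m|)
                     (allWords-complete (fixed m z))
      merged : merge m y (fixed m z) ≡ z
      merged = begin
        merge m y (fixed m z)          ≡⟨ merge-take m y (fixed m z) ⟩
        merge m y′ (fixed m z)         ≡⟨ cong (λ w → merge m w (fixed m z)) (sym (≡ʷ-sound free≡)) ⟩
        merge m (free m z) (fixed m z) ≡⟨ merge-free-fixed m z |z|≡|m| ⟩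
        z                              ∎
        where open ≡-Reasoning

  count-free : ∀ m (w : Word k) → length w ≡ falses m →
    ℕΣ.sum (map (λ z → ind (free m z ≡ʷ w)) (allWords k (length m))) ≡ k ^ trues m
  count-free []          []      _  = refl
  count-free (true ∷ m)  w       eq = begin
    ℕΣ.sum (map (λ z → ind (free (true ∷ m) z ≡ʷ w)) (allWords k (suc (length m))))
      ≡⟨ sum-allWords-suc {k = k} (length m) _ ⟩
    ℕΣ.sum (map (λ _ → ℕΣ.sum (map (λ z → ind (free m z ≡ʷ w)) (allWords k (length m)))) (allFin k))
      ≡⟨ cong ℕΣ.sum (ListP.map-cong (λ _ → count-free m w eq) (allFin k)) ⟩
    ℕΣ.sum (map (λ _ → k ^ trues m) (allFin k))
      ≡⟨ sum-constℕ (k ^ trues m) (allFin k) ⟩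
    length (allFin k) * k ^ trues m
      ≡⟨ cong (_* k ^ trues m) (ListP.length-tabulate {n = k} (λ a → a)) ⟩
    k * k ^ trues m ∎
    where open ≡-Reasoning
  count-free (false ∷ m) (b ∷ w) eq =
    trans (sum-allWords-suc {k = k} (length m) _)
          (trans (sum-cons-match {k = k} b (free m) w (allWords k (length m)))
                 (count-free m w (ℕP.suc-injective eq)))

  countIn-sum : ∀ (A : Subset k) S n → countIn A S n ≡ ℕΣ.sum (map (λ z → ind (A z ∧ (z ∈ᵇ S))) (allWords k n))
  countIn-sum A S n = length-filterᵇ _ (allWords k n)

  countLevel-sum : ∀ (A : Subset k) n → countLevel A n ≡ ℕΣ.sum (map (λ z → ind (A z)) (allWords k n))
  countLevel-sum A n = trans (countIn-sum A (allWords k n) n)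
    (cong ℕΣ.sum (ListP.map-cong-local (All.map in-level (allWords-sound n))))
    where
    in-level : ∀ {z} → length z ≡ n → ind (A z ∧ (z ∈ᵇ allWords k n)) ≡ ind (A z)
    in-level {z} refl = cong ind (trans (cong (A z ∧_) (∈ᵇ-complete (allWords-complete z))) (BoolP.∧-identityʳ (A z)))

  fibre-count : ∀ (A : Subset k) m (y : Word k) → falses m ≤ length y →
    countIn A (fibre m y) (length m) ≡
    ℕΣ.sum (map (λ z → ind (A z ∧ (free m z ≡ʷ take (falses m) y))) (allWords k (length m)))
  fibre-count A m y f≤|y| = trans (countIn-sum A (fibre m y) (length m))
    (cong ℕΣ.sum (ListP.map-cong-local (All.map
      (λ {z} |z|≡|m| → cong (λ b → ind (A z ∧ b)) (∈-fibre m y z f≤|y| |z|≡|m|))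
      (allWords-sound (length m)))))

  fibre-size : ∀ m (y : Word k) → falses m ≤ length y → countSet (fibre m y) (length m) ≡ k ^ trues m
  fibre-size m y f≤|y| =
    trans (fibre-count (λ _ → true) m y f≤|y|) (count-free m (take (falses m) y) (length-take-≤ _ y f≤|y|))

  -- Double counting: as y runs over [k]^N, each word of length |m| lies in
  -- exactly k^{N - falses m} fibres.
  fibre-total : ∀ (A : Subset k) N m → falses m ≤ N →
    ℕΣ.sum (map (λ y → countIn A (fibre m y) (length m)) (allWords k N)) ≡
    countLevel A (length m) * k ^ (N ∸ falses m)
  fibre-total A N m f≤N = begin
    ℕΣ.sum (map (λ y → countIn A (fibre m y) (length m)) Ys)
      ≡⟨ cong ℕΣ.sum (ListP.map-cong-local (All.map (λ |y|≡N → fibre-count A m _ (subst (f ≤_) (sym |y|≡N) f≤N)) (allWords-sound N))) ⟩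
    ℕΣ.sum (map (λ y → ℕΣ.sum (map (λ z → ind (A z ∧ (free m z ≡ʷ take f y))) Zs)) Ys)
      ≡⟨ cong ℕΣ.sum (ListP.map-cong (λ y → cong ℕΣ.sum (ListP.map-cong (λ z → split z y) Zs)) Ys) ⟩
    ℕΣ.sum (map (λ y → ℕΣ.sum (map (λ z → ind (A z) * ind (take f y ≡ʷ free m z)) Zs)) Ys)
      ≡⟨ ℕΣ.sum-swap (λ y z → ind (A z) * ind (take f y ≡ʷ free m z)) Ys Zs ⟩
    ℕΣ.sum (map (λ z → ℕΣ.sum (map (λ y → ind (A z) * ind (take f y ≡ʷ free m z)) Ys)) Zs)
      ≡⟨ cong ℕΣ.sum (ListP.map-cong-local (All.map prefix-count (allWords-sound (length m)))) ⟩
    ℕΣ.sum (map (λ z → ind (A z) * k ^ (N ∸ f)) Zs)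
      ≡⟨ ℕΣ.sum-*ʳ (k ^ (N ∸ f)) (λ z → ind (A z)) Zs ⟩
    ℕΣ.sum (map (λ z → ind (A z)) Zs) * k ^ (N ∸ f)
      ≡⟨ cong (_* k ^ (N ∸ f)) (sym (countLevel-sum A (length m))) ⟩
    countLevel A (length m) * k ^ (N ∸ f) ∎
    where
    open ≡-Reasoning
    f = falses m
    Ys = allWords k N
    Zs = allWords k (length m)
    split : ∀ z y → ind (A z ∧ (free m z ≡ʷ take f y)) ≡ ind (A z) * ind (take f y ≡ʷ free m z)
    split z y = trans (ind-∧ (A z) _) (cong (λ b → ind (A z) * ind b) (≡ʷ-sym (free m z) (take f y)))
    prefix-count : ∀ {z} → length z ≡ length m →
      ℕΣ.sum (map (λ y → ind (A z) * ind (take f y ≡ʷ free m z)) Ys) ≡ ind (A z) * k ^ (N ∸ f)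
    prefix-count {z} |z|≡|m| = trans (ℕΣ.sum-*ˡ (ind (A z)) _ Ys)
      (cong (ind (A z) *_) (count-prefix N f (free m z) (length-free m z |z|≡|m|) f≤N))

  fibreDensity : Subset k → Mask → Word k → ℚ
  fibreDensity A m y = frac (countIn A (fibre m y) (length m)) (countSet (fibre m y) (length m))

module _ {k : ℕ} .{{_ : NonZero k}} where

  k^≢0 : ∀ n → NonZero (k ^ n)
  k^≢0 n = ℕP.m^n≢0 k n

  fibre-average : ∀ (A : Subset k) N m → falses m ≤ N →
    frac 1 (k ^ N) ℚ.* sumℚ (map (fibreDensity A m) (allWords k N)) ≡ frac (countLevel A (length m)) (k ^ length m)
  fibre-average A N m f≤N = begin
    frac 1 (k ^ N) ℚ.* sumℚ (map (λ y → frac (C y) (countSet (fibre m y) (length m))) Ys)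
      ≡⟨ cong (λ s → frac 1 (k ^ N) ℚ.* sumℚ s) (ListP.map-cong-local (All.map
           (λ |y|≡N → cong (frac (C _)) (fibre-size {k = k} m _ (subst (f ≤_) (sym |y|≡N) f≤N))) (allWords-sound {k = k} N))) ⟩
    frac 1 (k ^ N) ℚ.* sumℚ (map (λ y → frac (C y) (k ^ t)) Ys)
      ≡⟨ cong (frac 1 (k ^ N) ℚ.*_) (frac-sum C (k ^ t) {{k^≢0 t}} Ys) ⟩
    frac 1 (k ^ N) ℚ.* frac (ℕΣ.sum (map C Ys)) (k ^ t)
      ≡⟨ frac-* _ (k ^ N) (k ^ t) {{k^≢0 N}} {{k^≢0 t}} ⟩
    frac (ℕΣ.sum (map C Ys)) (k ^ N * k ^ t)
      ≡⟨ cong₂ frac (trans (fibre-total {k = k} A N m f≤N) (ℕP.*-comm _ (k ^ (N ∸ f)))) powers ⟩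
    frac (k ^ (N ∸ f) * countLevel A (length m)) (k ^ (N ∸ f) * k ^ length m)
      ≡⟨ frac-cancel _ (k ^ (N ∸ f)) (k ^ length m) {{k^≢0 (N ∸ f)}} {{k^≢0 (length m)}} ⟩
    frac (countLevel A (length m)) (k ^ length m) ∎
    where
    open ≡-Reasoning
    f = falses m
    t = trues m
    Ys = allWords k N
    C : Word k → ℕ
    C y = countIn A (fibre m y) (length m)
    exponents : N + t ≡ (N ∸ f) + length m
    exponents = begin
      N + t                ≡⟨ cong (_+ t) (sym (ℕP.m∸n+n≡m f≤N)) ⟩
      (N ∸ f) + f + t      ≡⟨ ℕP.+-assoc (N ∸ f) f t ⟩
      (N ∸ f) + (f + t)    ≡⟨ cong ((N ∸ f) +_) (trans (ℕP.+-comm f t) (sym (length-mask m))) ⟩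
      (N ∸ f) + length m   ∎
    powers : k ^ N * k ^ t ≡ k ^ (N ∸ f) * k ^ length m
    powers = trans (sym (ℕP.^-distribˡ-+-* k N t))
                   (trans (cong (k ^_) exponents) (ℕP.^-distribˡ-+-* k (N ∸ f) (length m)))

window : ℕ → ℕ → List ℕ → Mask
window p zero    M = []
window p (suc n) M = (p ∈ℕ M) ∷ window (suc p) n M

length-window : ∀ p n M → length (window p n M) ≡ n
length-window p zero    M = refl
length-window p (suc n) M = cong suc (length-window (suc p) n M)

cvScan-window : ∀ {k} p n M (t x : Word k) → cvScan p n M t x ≡ merge (window p n M) x t
cvScan-window p zero    M t x = refl
cvScan-window p (suc n) M t x with p ∈ℕ M
cvScan-window p (suc n) M (a ∷ t) x       | true  = cong (a ∷_) (cvScan-window (suc p) n M t x)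
cvScan-window p (suc n) M []      x       | true  = refl
cvScan-window p (suc n) M t       (b ∷ x) | false = cong (b ∷_) (cvScan-window (suc p) n M t x)
cvScan-window p (suc n) M t       []      | false = refl

window-empty : ∀ p n → window p n [] ≡ replicate n false
window-empty p zero    = refl
window-empty p (suc n) = cong (false ∷_) (window-empty (suc p) n)

∉-below : ∀ p M → All (p <_) M → p ∈ℕ M ≡ false
∉-below p []      []           = refl
∉-below p (q ∷ M) (p<q ∷ p<M) = cong₂ _∨_ (isYes-false (p ℕ.≟ q) (ℕP.<⇒≢ p<q)) (∉-below p M p<M)

window-skip : ∀ p d q n M → p + d ≡ q → All (q ≤_) M →
  window p (d + n) M ≡ replicate d false ++ window q n M
window-skip p zero    q n M p+0≡q q≤M = cong (λ r → window r n M) (trans (sym (ℕP.+-identityʳ p)) p+0≡q)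
window-skip p (suc d) q n M p+d≡q q≤M =
  cong₂ _∷_ (∉-below p M (All.map (ℕP.<-≤-trans p<q) q≤M))
            (window-skip (suc p) d q n M (trans (sym (ℕP.+-suc p d)) p+d≡q) q≤M)
  where
  p<q : p < q
  p<q = subst (p <_) p+d≡q (ℕP.m<m+n p ℕ.z<s)

window-drop : ∀ q p n M → q < p → window p n (q ∷ M) ≡ window p n M
window-drop q p zero    M q<p = refl
window-drop q p (suc n) M q<p =
  cong₂ _∷_ (cong (_∨ (p ∈ℕ M)) (isYes-false (p ℕ.≟ q) (λ p≡q → ℕP.<⇒≢ q<p (sym p≡q))))
            (window-drop q (suc p) n M (ℕP.m<n⇒m<1+n q<p))

gaps : ℕ → List ℕ → List ℕ
gaps p []       = []
gaps p (l ∷ ls) = (l ∸ suc p) ∷ gaps l ls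

length-gaps : ∀ p ls → length (gaps p ls) ≡ length ls
length-gaps p []       = refl
length-gaps p (l ∷ ls) = cong suc (length-gaps l ls)

gaps-take : ∀ p i ls → gaps p (take i ls) ≡ take i (gaps p ls)
gaps-take p zero    ls       = refl
gaps-take p (suc i) []       = refl
gaps-take p (suc i) (l ∷ ls) = cong (_ ∷_) (gaps-take l i ls)

gaps-take-≤ : ∀ p i ls → ℕΣ.sum (gaps p (take i ls)) ≤ ℕΣ.sum (gaps p ls)
gaps-take-≤ p zero    ls       = z≤n
gaps-take-≤ p (suc i) []       = z≤n
gaps-take-≤ p (suc i) (l ∷ ls) = ℕP.+-monoʳ-≤ (l ∸ suc p) (gaps-take-≤ l i ls)

gapMask : ℕ → List ℕ → Mask
gapMask d gs = replicate d false ++ concatMap (λ g → true ∷ replicate g false) gs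

trues-gapMask : ∀ d gs → trues (gapMask d gs) ≡ length gs
trues-gapMask zero    []       = refl
trues-gapMask zero    (g ∷ gs) = cong suc (trues-gapMask g gs)
trues-gapMask (suc d) gs       = trues-gapMask d gs

falses-gapMask : ∀ d gs → falses (gapMask d gs) ≡ d + ℕΣ.sum gs
falses-gapMask zero    []       = refl
falses-gapMask zero    (g ∷ gs) = falses-gapMask g gs
falses-gapMask (suc d) gs       = cong suc (falses-gapMask d gs)

length-gapMask : ∀ d gs → length (gapMask d gs) ≡ d + ℕΣ.sum (map suc gs)
length-gapMask zero    []       = refl
length-gapMask zero    (g ∷ gs) = cong suc (length-gapMask g gs)
length-gapMask (suc d) gs       = cong suc (length-gapMask d gs)

linked-head : ∀ {p ls} → Linked _<_ (p ∷ ls) → All (p <_) ls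
linked-head [-]              = []
linked-head (p<q ∷ linked) = LinkedP.Linked⇒All ℕP.<-trans p<q linked

linked-tail : ∀ {p ls} → Linked _<_ (p ∷ ls) → Linked _<_ ls
linked-tail [-]          = []
linked-tail (_ ∷ linked) = linked

All-lookup : ∀ {P : ℕ → Set} {xs} → All P xs → (i : Fin (length xs)) → P (lookup xs i)
All-lookup (px ∷ _)  Fin.zero    = px
All-lookup (_ ∷ pxs) (Fin.suc i) = All-lookup pxs i

window-gaps : ∀ p l L' (i : Fin (length (l ∷ L'))) → p ≤ l → Linked _<_ (l ∷ L') →
  window p (lookup (l ∷ L') i ∸ p) (take (toℕ i) (l ∷ L')) ≡ gapMask (l ∸ p) (gaps l (take (toℕ i) L'))
window-gaps p l L' Fin.zero p≤l sorted =
  trans (window-empty p (l ∸ p)) (sym (ListP.++-identityʳ (replicate (l ∸ p) false)))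
window-gaps p l (l′ ∷ L″) (Fin.suc i) p≤l sorted = begin
  window p (E ∸ p) (l ∷ M)
    ≡⟨ cong (λ n → window p n (l ∷ M)) length-split ⟩
  window p ((l ∸ p) + suc (E ∸ suc l)) (l ∷ M)
    ≡⟨ window-skip p (l ∸ p) l (suc (E ∸ suc l)) (l ∷ M) (ℕP.m+[n∸m]≡n p≤l) (ℕP.≤-refl ∷ l≤M) ⟩
  replicate (l ∸ p) false ++ (l ∈ℕ (l ∷ M)) ∷ window (suc l) (E ∸ suc l) (l ∷ M)
    ≡⟨ cong (λ w → replicate (l ∸ p) false ++ w) (cong₂ _∷_ hit (window-drop l (suc l) (E ∸ suc l) M (ℕP.n<1+n l))) ⟩
  replicate (l ∸ p) false ++ true ∷ window (suc l) (E ∸ suc l) M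
    ≡⟨ cong (λ w → replicate (l ∸ p) false ++ true ∷ w) (window-gaps (suc l) l′ L″ i l<l′ (linked-tail sorted)) ⟩
  gapMask (l ∸ p) (gaps l (take (toℕ (Fin.suc i)) (l′ ∷ L″))) ∎
  where
  open ≡-Reasoning
  E = lookup (l′ ∷ L″) i
  M = take (toℕ i) (l′ ∷ L″)
  l<l′ : l < l′
  l<l′ = All-lookup (linked-head sorted) Fin.zero
  l<E : l < E
  l<E = All-lookup (linked-head sorted) i
  l≤M : All (l ≤_) M
  l≤M = AllP.take⁺ (toℕ i) (All.map ℕP.<⇒≤ (linked-head sorted))
  hit : l ∈ℕ (l ∷ M) ≡ true
  hit = cong (_∨ (l ∈ℕ M)) (isYes-true (l ℕ.≟ l) refl)
  length-split : E ∸ p ≡ (l ∸ p) + suc (E ∸ suc l)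
  length-split = trans (cong (_∸ p) (sym ends)) (ℕP.m+n∸m≡n p _)
    where
    ends : p + ((l ∸ p) + suc (E ∸ suc l)) ≡ E
    ends = begin
      p + ((l ∸ p) + suc (E ∸ suc l))  ≡⟨ sym (ℕP.+-assoc p (l ∸ p) _) ⟩
      p + (l ∸ p) + suc (E ∸ suc l)    ≡⟨ cong (_+ suc (E ∸ suc l)) (ℕP.m+[n∸m]≡n p≤l) ⟩
      l + suc (E ∸ suc l)              ≡⟨ ℕP.+-suc l (E ∸ suc l) ⟩
      suc l + (E ∸ suc l)              ≡⟨ ℕP.m+[n∸m]≡n l<E ⟩
      E                                ∎

last-gaps : ∀ l L' → Linked _<_ (l ∷ L') → fromMaybe 0 (last (l ∷ L')) ≡ l + ℕΣ.sum (map suc (gaps l L'))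
last-gaps l []          sorted = sym (ℕP.+-identityʳ l)
last-gaps l (l′ ∷ L″) sorted = begin
  fromMaybe 0 (last (l′ ∷ L″))                         ≡⟨ last-gaps l′ L″ (linked-tail sorted) ⟩
  l′ + S                                               ≡⟨ cong (_+ S) (sym l+gap≡l′) ⟩
  l + suc (l′ ∸ suc l) + S                             ≡⟨ ℕP.+-assoc l (suc (l′ ∸ suc l)) S ⟩
  l + ℕΣ.sum (map suc (gaps l (l′ ∷ L″)))              ∎
  where
  open ≡-Reasoning
  S = ℕΣ.sum (map suc (gaps l′ L″))
  l+gap≡l′ : l + suc (l′ ∸ suc l) ≡ l′
  l+gap≡l′ = trans (ℕP.+-suc l _) (ℕP.m+[n∸m]≡n (All-lookup (linked-head sorted) Fin.zero))

sum-map-suc : ∀ xs → ℕΣ.sum (map suc xs) ≡ ℕΣ.sum xs + length xs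
sum-map-suc []       = refl
sum-map-suc (x ∷ xs) = trans (cong suc (cong (x +_) (sum-map-suc xs)))
  (trans (cong suc (sym (ℕP.+-assoc x _ (length xs)))) (sym (ℕP.+-suc (x + ℕΣ.sum xs) (length xs))))

-- a ≤ (a + b) - (b + 1) + 1, the shape of |X_L| = max L - |L| + 1.
≤-xLen : ∀ a b → a ≤ (a + b ∸ suc b) + 1
≤-xLen zero    b = z≤n
≤-xLen (suc a) b = ℕP.≤-reflexive (trans (cong suc (sym (ℕP.m+n∸n≡m a b))) (ℕP.+-comm 1 _))

gaps-fit : ∀ l L' → Linked _<_ (l ∷ L') → l + ℕΣ.sum (gaps l L') ≤ xLen (l ∷ L')
gaps-fit l L' sorted = subst (λ e → F ≤ (e ∸ suc (length L')) + 1) (sym last≡) (≤-xLen F (length L'))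
  where
  F = l + ℕΣ.sum (gaps l L')
  last≡ : fromMaybe 0 (last (l ∷ L')) ≡ F + length L'
  last≡ = begin
    fromMaybe 0 (last (l ∷ L'))                         ≡⟨ last-gaps l L' sorted ⟩
    l + ℕΣ.sum (map suc (gaps l L'))                    ≡⟨ cong (l +_) (sum-map-suc (gaps l L')) ⟩
    l + (ℕΣ.sum (gaps l L') + length (gaps l L'))       ≡⟨ sym (ℕP.+-assoc l _ _) ⟩
    F + length (gaps l L')                              ≡⟨ cong (F +_) (length-gaps l L') ⟩
    F + length L'                                       ∎
    where open ≡-Reasoning

module _ {k : ℕ} where

  gapWords : List ℕ → Word k → List (LVWord k)
  gapWords []       y = []
  gapWords (g ∷ gs) y = map just (take g y) ∷ gapWords gs (drop g y)

  length-gapWords : ∀ gs y → length (gapWords gs y) ≡ length gs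
  length-gapWords []       y = refl
  length-gapWords (g ∷ gs) y = cong suc (length-gapWords gs (drop g y))

  take-gapWords : ∀ j gs y → take j (gapWords gs y) ≡ gapWords (take j gs) y
  take-gapWords zero    gs       y = refl
  take-gapWords (suc j) []       y = refl
  take-gapWords (suc j) (g ∷ gs) y = cong (_ ∷_) (take-gapWords j gs (drop g y))

  block-fits : ∀ g s (y : Word k) → g + s ≤ length y → length (map just (take g y)) ≡ g
  block-fits g s y g+s≤ = trans (ListP.length-map just (take g y)) (length-take-≤ g y (ℕP.≤-trans (ℕP.m≤m+n g s) g+s≤))

  rest-fits : ∀ g s (y : Word k) → g + s ≤ length y → s ≤ length (drop g y)
  rest-fits g s y g+s≤ = subst (s ≤_) (sym (ListP.length-drop g y))
    (subst (_≤ length y ∸ g) (ℕP.m+n∸m≡n g s) (ℕP.∸-monoˡ-≤ g g+s≤))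

  substLV-just : ∀ (u : Word k) a → substLV (map just u) a ≡ a ∷ u
  substLV-just u a = cong (a ∷_) (trans (sym (ListP.map-∘ u)) (ListP.map-id u))

  merge-pad : ∀ d m (y t : Word k) → d ≤ length y → merge (replicate d false ++ m) y t ≡ take d y ++ merge m (drop d y) t
  merge-pad zero    m y       t _         = refl
  merge-pad (suc d) m (b ∷ y) t (s≤s d≤) = cong (b ∷_) (merge-pad d m y t d≤)

  levelFrom-gapWords : ∀ (c : Word k) gs y → ℕΣ.sum gs ≤ length y →
    levelFrom c (gapWords gs y) ≡ map (λ t → c ++ merge (gapMask 0 gs) y t) (allWords k (length gs))
  levelFrom-gapWords c []       y _  = cong (_∷ []) (sym (ListP.++-identityʳ c))
  levelFrom-gapWords c (g ∷ gs) y fits = begin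
    concatMap (λ a → levelFrom (c ++ substLV (map just (take g y)) a) (gapWords gs (drop g y))) (allFin k)
      ≡⟨ ListP.concatMap-cong (λ a → trans (cong (λ w → levelFrom (c ++ w) (gapWords gs (drop g y))) (substLV-just (take g y) a))
           (trans (levelFrom-gapWords (c ++ a ∷ take g y) gs (drop g y) (rest-fits g _ y fits))
                  (ListP.map-cong (reassociate a) (allWords k (length gs))))) (allFin k) ⟩
    concatMap (λ a → map (λ t → c ++ merge (gapMask 0 (g ∷ gs)) y (a ∷ t)) (allWords k (length gs))) (allFin k)
      ≡⟨ ListP.concatMap-cong (λ a → ListP.map-∘ (allWords k (length gs))) (allFin k) ⟩
    concatMap (map (λ t → c ++ merge (gapMask 0 (g ∷ gs)) y t) ∘ (λ a → map (a ∷_) (allWords k (length gs)))) (allFin k)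
      ≡⟨ sym (ListP.map-concatMap _ _ (allFin k)) ⟩
    map (λ t → c ++ merge (gapMask 0 (g ∷ gs)) y t) (allWords k (length (g ∷ gs))) ∎
    where
    open ≡-Reasoning
    reassociate : ∀ a t → (c ++ a ∷ take g y) ++ merge (gapMask 0 gs) (drop g y) t ≡
                          c ++ merge (gapMask 0 (g ∷ gs)) y (a ∷ t)
    reassociate a t = trans (ListP.++-assoc c (a ∷ take g y) _)
      (cong (λ w → c ++ a ∷ w) (sym (merge-pad g (gapMask 0 gs) y t (ℕP.≤-trans (ℕP.m≤m+n g _) fits))))

  -- ℓ_j - ℓ_0 for the first j variable words (as in `levelLen` of Defs).
  sumLens : List (LVWord k) → ℕ
  sumLens = foldr (λ w s → suc (length w) + s) 0

  sumLens-gapWords : ∀ gs y → ℕΣ.sum gs ≤ length y → sumLens (gapWords gs y) ≡ ℕΣ.sum (map suc gs)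
  sumLens-gapWords []       y _    = refl
  sumLens-gapWords (g ∷ gs) y fits =
    cong suc (cong₂ _+_ (block-fits g _ y fits) (sumLens-gapWords gs (drop g y) (rest-fits g _ y fits)))

  levelsFrom-gapWords : ∀ p L' y → Linked _<_ (p ∷ L') → ℕΣ.sum (gaps p L') ≤ length y →
    levelsFrom p (gapWords (gaps p L') y) ≡ p ∷ L'
  levelsFrom-gapWords p []          y sorted fits = refl
  levelsFrom-gapWords p (l′ ∷ L″) y sorted fits = cong (p ∷_) (begin
    levelsFrom (p + suc (length (map just (take g y)))) (gapWords (gaps l′ L″) (drop g y))
      ≡⟨ cong (λ q → levelsFrom (p + suc q) rest) (block-fits g _ y fits) ⟩
    levelsFrom (p + suc g) (gapWords (gaps l′ L″) (drop g y))
      ≡⟨ cong (λ q → levelsFrom q rest) (trans (ℕP.+-suc p g) (ℕP.m+[n∸m]≡n (All-lookup (linked-head sorted) Fin.zero))) ⟩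
    levelsFrom l′ (gapWords (gaps l′ L″) (drop g y))
      ≡⟨ levelsFrom-gapWords l′ L″ (drop g y) (linked-tail sorted) (rest-fits g _ y fits) ⟩
    l′ ∷ L″ ∎)
    where
    open ≡-Reasoning
    g = l′ ∸ suc p
    rest = gapWords (gaps l′ L″) (drop g y)

module Convolution {k : ℕ} (l : ℕ) (L' : List ℕ) (sorted : Linked _<_ (l ∷ L')) where

  L : List ℕ
  L = l ∷ L'

  N : ℕ
  N = xLen L

  gapsTo : Fin (length L) → List ℕ
  gapsTo i = gaps l (take (toℕ i) L')

  mask : Fin (length L) → Mask
  mask i = gapMask l (gapsTo i)

  mask-window : ∀ i → window 0 (lookup L i) (take (toℕ i) L) ≡ mask i
  mask-window i = window-gaps 0 l L' i z≤n sorted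

  length-mask-at : ∀ i → length (mask i) ≡ lookup L i
  length-mask-at i = trans (cong length (sym (mask-window i))) (length-window 0 (lookup L i) _)

  trues-mask : ∀ i → trues (mask i) ≡ toℕ i
  trues-mask i = trans (trues-gapMask l (gapsTo i))
    (trans (length-gaps l (take (toℕ i) L')) (length-take-≤ (toℕ i) L' (ℕP.≤-pred (FinP.toℕ<n i))))

  falses-mask : ∀ i → falses (mask i) ≤ N
  falses-mask i = subst (_≤ N) (sym (falses-gapMask l (gapsTo i)))
    (ℕP.≤-trans (ℕP.+-monoʳ-≤ l (gaps-take-≤ l (toℕ i) L')) (gaps-fit l L' sorted))

  R-fibre : ∀ (x : Word k) i → R L x i ≡ fibre (mask i) x
  R-fibre x i = begin
    map (λ t → cvScan 0 (lookup L i) (take (toℕ i) L) t x) (allWords k (toℕ i))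
      ≡⟨ ListP.map-cong (λ t → trans (cvScan-window 0 (lookup L i) _ t x) (cong (λ m → merge m x t) (mask-window i)))
                        (allWords k (toℕ i)) ⟩
    map (merge (mask i) x) (allWords k (toℕ i))
      ≡⟨ cong (λ n → map (merge (mask i) x) (allWords k n)) (sym (trues-mask i)) ⟩
    fibre (mask i) x ∎
    where open ≡-Reasoning

  summand-fibre : ∀ (A : Subset k) x i →
    frac (countIn A (R L x i) (lookup L i)) (countSet (R L x i) (lookup L i)) ≡ fibreDensity A (mask i) x
  summand-fibre A x i = cong₂ frac (cong₂ (countIn A) (R-fibre x i) (sym (length-mask-at i)))
                                   (cong₂ countSet (R-fibre x i) (sym (length-mask-at i)))

  identity : .{{_ : NonZero k}} (A : Subset k) → lhs k A L ≡ rhs k A L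
  identity A = begin
    frac 1 (k ^ N) ℚ.* sumℚ (map (innerAvg A L) (allWords k N))
      ≡⟨ cong (λ s → frac 1 (k ^ N) ℚ.* sumℚ s)
              (ListP.map-cong (λ x → cong (frac 1 n ℚ.*_) (cong sumℚ (ListP.map-cong (summand-fibre A x) (allFin n))))
                              (allWords k N)) ⟩
    frac 1 (k ^ N) ℚ.* sumℚ (map (λ x → frac 1 n ℚ.* sumℚ (map (λ i → fibreDensity A (mask i) x) (allFin n))) (allWords k N))
      ≡⟨ average-swap (λ x i → fibreDensity A (mask i) x) (frac 1 (k ^ N)) (frac 1 n) (allWords k N) (allFin n) ⟩
    frac 1 n ℚ.* sumℚ (map (λ i → frac 1 (k ^ N) ℚ.* sumℚ (map (fibreDensity A (mask i)) (allWords k N))) (allFin n))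
      ≡⟨ cong (λ s → frac 1 n ℚ.* sumℚ s) (ListP.map-cong level-average (allFin n)) ⟩
    frac 1 n ℚ.* sumℚ (map (λ i → levelDensity (lookup L i)) (allFin n))
      ≡⟨ cong (λ s → frac 1 n ℚ.* sumℚ s) (map-lookup levelDensity L) ⟩
    frac 1 n ℚ.* sumℚ (map levelDensity L) ∎
    where
    open ≡-Reasoning
    n = length L
    levelDensity : ℕ → ℚ
    levelDensity m = frac (countLevel A m) (k ^ m)
    level-average : ∀ i → frac 1 (k ^ N) ℚ.* sumℚ (map (fibreDensity A (mask i)) (allWords k N)) ≡ levelDensity (lookup L i)
    level-average i = trans (fibre-average A N (mask i) (falses-mask i)) (cong levelDensity (length-mask-at i))

  tree : Word k → CSTree k
  tree x = cstree (take l x) (gapWords (gaps l L') (drop l x))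

  dim-tree : ∀ x → dim (tree x) ≡ length L ∸ 1
  dim-tree x = trans (length-gapWords (gaps l L') (drop l x)) (length-gaps l L')

  module _ (x : Word k) (|x|≡N : length x ≡ N) where

    fits : ∀ s → s ≤ ℕΣ.sum (gaps l L') → s ≤ length (drop l x)
    fits s s≤ = rest-fits l s x (subst (l + s ≤_) (sym |x|≡N) (ℕP.≤-trans (ℕP.+-monoʳ-≤ l s≤) (gaps-fit l L' sorted)))

    l≤|x| : l ≤ length x
    l≤|x| = subst (l ≤_) (sym |x|≡N) (ℕP.≤-trans (ℕP.m≤m+n l _) (gaps-fit l L' sorted))

    levelSet-tree : levelSet (tree x) ≡ L
    levelSet-tree = trans (cong (λ p → levelsFrom p (gapWords (gaps l L') (drop l x))) (length-take-≤ l x l≤|x|))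
      (levelsFrom-gapWords l L' (drop l x) sorted (fits _ ℕP.≤-refl))

    first-blocks : ∀ {m} (j : Fin m) i → toℕ j ≡ toℕ i →
      take (toℕ j) (gapWords (gaps l L') (drop l x)) ≡ gapWords (gapsTo i) (drop l x)
    first-blocks j i j≡i = trans (take-gapWords (toℕ j) (gaps l L') (drop l x))
      (cong (λ gs → gapWords gs (drop l x)) (trans (cong (λ q → take q (gaps l L')) j≡i) (sym (gaps-take l (toℕ i) L'))))

    prefix-fits : ∀ i → ℕΣ.sum (gapsTo i) ≤ length (drop l x)
    prefix-fits i = fits _ (gaps-take-≤ l (toℕ i) L')

    level-tree : ∀ j i → toℕ j ≡ toℕ i → level (tree x) j ≡ R L x i
    level-tree j i j≡i = begin
      levelFrom (take l x) (take (toℕ j) (gapWords (gaps l L') (drop l x)))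
        ≡⟨ cong (levelFrom (take l x)) (first-blocks j i j≡i) ⟩
      levelFrom (take l x) (gapWords (gapsTo i) (drop l x))
        ≡⟨ levelFrom-gapWords (take l x) (gapsTo i) (drop l x) (prefix-fits i) ⟩
      map (λ t → take l x ++ merge (gapMask 0 (gapsTo i)) (drop l x) t) (allWords k (length (gapsTo i)))
        ≡⟨ ListP.map-cong (λ t → sym (merge-pad l (gapMask 0 (gapsTo i)) x t l≤|x|)) (allWords k (length (gapsTo i))) ⟩
      map (merge (mask i) x) (allWords k (length (gapsTo i)))
        ≡⟨ cong (λ n → map (merge (mask i) x) (allWords k n)) (sym (trues-gapMask l (gapsTo i))) ⟩
      fibre (mask i) x
        ≡⟨ sym (R-fibre x i) ⟩
      R L x i ∎
      where open ≡-Reasoning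

    levelLen-tree : ∀ j i → toℕ j ≡ toℕ i → levelLen (tree x) j ≡ lookup L i
    levelLen-tree j i j≡i = begin
      length (take l x) + sumLens (take (toℕ j) (gapWords (gaps l L') (drop l x)))
        ≡⟨ cong₂ _+_ (length-take-≤ l x l≤|x|) (cong sumLens (first-blocks j i j≡i)) ⟩
      l + sumLens (gapWords (gapsTo i) (drop l x))
        ≡⟨ cong (l +_) (sumLens-gapWords (gapsTo i) (drop l x) (prefix-fits i)) ⟩
      l + ℕΣ.sum (map suc (gapsTo i))
        ≡⟨ sym (length-gapMask l (gapsTo i)) ⟩
      length (mask i)
        ≡⟨ length-mask-at i ⟩
      lookup L i ∎
      where open ≡-Reasoning

    treeAvg-tree : ∀ (A : Subset k) → treeAvg A (tree x) ≡ innerAvg A L x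
    treeAvg-tree A = average-reindex (cong suc (dim-tree x)) _ _ (λ j i j≡i →
      cong₂ frac (cong₂ (countIn A) (level-tree j i j≡i) (levelLen-tree j i j≡i))
                 (cong₂ countSet (level-tree j i j≡i) (levelLen-tree j i j≡i)))

lemma7p7 : (k : ℕ) → 2 ≤ k → (L : List ℕ) → Linked _<_ L → 2 ≤ length L →
    (A : Subset k) →
    (lhs k A L ≡ rhs k A L) ×
    Σ (CSTree k) (λ W → (dim W ≡ length L ∸ 1) × (levelSet W ≡ L) × (rhs k A L ≤ℚ treeAvg A W))
lemma7p7 (suc k) _ [] _ ()
lemma7p7 (suc k) _ (l ∷ L') sorted _ A =
  identity A , tree x , dim-tree x , levelSet-tree x |x|≡N , rhs≤treeAvg
  where
  open Convolution l L' sorted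
  Xs = allWords (suc k) N
  -- X_L is nonempty, so some x ∈ X_L is at least the average of innerAvg over X_L.
  constant∈Xs : replicate N Fin.zero ∈ Xs
  constant∈Xs = subst (λ n → replicate N Fin.zero ∈ allWords (suc k) n) (ListP.length-replicate N)
                      (allWords-complete (replicate N Fin.zero))
  chosen = above-average (innerAvg A L) Xs constant∈Xs
  x = proj₁ chosen
  |x|≡N : length x ≡ N
  |x|≡N = All.lookup (allWords-sound N) (proj₁ (proj₂ chosen))
  average≡rhs : frac 1 (length Xs) ℚ.* sumℚ (map (innerAvg A L) Xs) ≡ rhs (suc k) A L
  average≡rhs = trans (cong (λ d → frac 1 d ℚ.* sumℚ (map (innerAvg A L) Xs)) (allWords-length N)) (identity A)
  rhs≤treeAvg : rhs (suc k) A L ≤ℚ treeAvg A (tree x)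
  rhs≤treeAvg = subst₂ _≤ℚ_ average≡rhs (sym (treeAvg-tree x |x|≡N A)) (proj₂ (proj₂ chosen))
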